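{- Let $m\ge2$. A vector of multiplicities $[k_1,\dots,k_{m-1},0]$ (nonnegative integers, last entry $0$) with $k_2>0$ is not allowable.
   Context: $(n_1,\dots,n_m)\times[k_1,\dots,k_m]$ denotes the partition with $k_i$ parts $n_i$ ($k_i\ge0$). The extended slow-Triangle map is $\tilde T=\tilde T_0$ if $n_2+n_m>n_1$ and $\tilde T=\tilde T_1$ if $n_2+n_m<n_1$ (undefined if equal), with $\tilde T_0((n_1,\dots,n_m)\times[k_1,\dots,k_m])=(n_2,\dots,n_m,n_1-n_2)\times[k_1+k_2,k_3,\dots,k_m,k_1]$ and $\tilde T_1((n_1,\dots,n_m)\times[k_1,\dots,k_m])=(n_1-n_m,n_2,\dots,n_m)\times[k_1,\dots,k_{m-1},k_1+k_m]$. A partition $\mu$ is a descendant of $\lambda$ if it is obtained from $\lambda$ by finitely many applications of $\tilde T$, each of them defined. A vector $[k_1,\dots,k_m]$ is allowable if there are integers $n_1>\cdots>n_m>0$ with $n_1\ne n_2+n_m$ and integers $a_1>\cdots>a_m>0$ such that $(a_1,\dots,a_m)\times[k_1,\dots,k_m]$ is a descendant of $(n_1,\dots,n_m)\times[1,0,\dots,0]$. -}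

module Defs where

open import Data.Nat using (ℕ; zero; suc; _+_; _∸_; _<_)
open import Data.Vec using (Vec; []; _∷_; _∷ʳ_; init; last; replicate)
open import Data.Product using (_×_; Σ; _,_; proj₁)
open import Data.Unit using (⊤)
open import Relation.Nullary using (¬_)
open import Relation.Binary.PropositionalEquality using (_≡_)
open import Relation.Binary.Construct.Closure.ReflexiveTransitive using (Star)

-- A partition (n_1,...,n_m) × [k_1,...,k_m] with m = j + 2 (so m ≥ 2),
-- represented by the pair of vectors (parts , multiplicities).
Part : ℕ → Set
Part j = Vec ℕ (suc (suc j)) × Vec ℕ (suc (suc j))

first : ∀ {j} → Vec ℕ (suc (suc j)) → ℕ
first (x ∷ _) = x

second : ∀ {j} → Vec ℕ (suc (suc j)) → ℕ
second (_ ∷ y ∷ _) = y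

lastEntry : ∀ {j} → Vec ℕ (suc (suc j)) → ℕ
lastEntry (_ ∷ ys) = last ys

T0 : ∀ {j} → Part j → Part j
T0 (n1 ∷ n2 ∷ ns , k1 ∷ k2 ∷ ks) = ((n2 ∷ ns) ∷ʳ (n1 ∸ n2)) , ((k1 + k2) ∷ (ks ∷ʳ k1))

T1 : ∀ {j} → Part j → Part j
T1 (n1 ∷ ns , k1 ∷ ks) = ((n1 ∸ last ns) ∷ ns) , (k1 ∷ (init ks ∷ʳ (k1 + last ks)))

data Step {j : ℕ} : Part j → Part j → Set where
  step0 : ∀ {p} → first (proj₁ p) < second (proj₁ p) + lastEntry (proj₁ p)
        → Step p (T0 p)
  step1 : ∀ {p} → second (proj₁ p) + lastEntry (proj₁ p) < first (proj₁ p)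
        → Step p (T1 p)

Descendant : ∀ {j} → Part j → Part j → Set
Descendant {j} lam mu = Star (Step {j}) lam mu

StrictDecPos : ∀ {n} → Vec ℕ n → Set
StrictDecPos [] = ⊤
StrictDecPos (x ∷ []) = 0 < x
StrictDecPos (x ∷ y ∷ r) = (y < x) × StrictDecPos (y ∷ r)

e1 : ∀ {j} → Vec ℕ (suc (suc j))
e1 {j} = 1 ∷ replicate (suc j) 0

Allowable : ∀ {j} → Vec ℕ (suc (suc j)) → Set
Allowable {j} ks =
  Σ (Vec ℕ (suc (suc j))) λ ns →
    StrictDecPos ns × ¬ (first ns ≡ second ns + lastEntry ns) ×
    Σ (Vec ℕ (suc (suc j))) λ as →
      StrictDecPos as × Descendant (ns , e1) (as , ks)

-- Every application of T̃ leaves k₁ positive and makes the new last multiplicity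
-- k₁ (for T̃₀) or k₁ + kₘ (for T̃₁). So every proper descendant of a partition
-- with k₁ > 0, in particular of (n₁,…,nₘ) × [1,0,…,0], has kₘ > 0, while the
-- partition itself has k₂ = 0.
module Submission where

open import Defs
open import Data.Nat using (ℕ; suc; _<_; _+_; z<s)
open import Data.Nat.Properties using (≤-trans; m≤m+n; <-irrefl)
open import Data.Vec using (Vec; lookup; _∷_; init; last)
open import Data.Vec.Properties using (last-∷ʳ)
open import Data.Fin using (zero; suc)
open import Data.Product using (_×_; _,_; proj₂)
open import Relation.Nullary using (¬_)
open import Relation.Binary.PropositionalEquality using (_≡_; sym; subst)
open import Relation.Binary.Construct.Closure.ReflexiveTransitive using (Star; ε; _◅_)

firstMult : ∀ {j} → Part j → ℕ
firstMult p = first (proj₂ p)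

lastMult : ∀ {j} → Part j → ℕ
lastMult p = lastEntry (proj₂ p)

step-firstMult-pos : ∀ {j} {p q : Part j} → Step p q → 0 < firstMult p → 0 < firstMult q
step-firstMult-pos (step0 {_ ∷ _ ∷ _ , k₁ ∷ k₂ ∷ _} _) k₁>0 = ≤-trans k₁>0 (m≤m+n k₁ k₂)
step-firstMult-pos (step1 {_ ∷ _ , _ ∷ _} _)          k₁>0 = k₁>0

step-lastMult-pos : ∀ {j} {p q : Part j} → Step p q → 0 < firstMult p → 0 < lastMult q
step-lastMult-pos (step0 {_ ∷ _ ∷ _ , k₁ ∷ _ ∷ ks} _) k₁>0 =
  subst (0 <_) (sym (last-∷ʳ k₁ ks)) k₁>0
step-lastMult-pos (step1 {_ ∷ _ , k₁ ∷ ks} _) k₁>0 =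
  subst (0 <_) (sym (last-∷ʳ (k₁ + last ks) (init ks))) (≤-trans k₁>0 (m≤m+n k₁ (last ks)))

BothEndMultsPos : ∀ {j} → Part j → Set
BothEndMultsPos p = 0 < firstMult p × 0 < lastMult p

step-bothEndMultsPos : ∀ {j} {p q : Part j} → Step p q → 0 < firstMult p → BothEndMultsPos q
step-bothEndMultsPos s k₁>0 = step-firstMult-pos s k₁>0 , step-lastMult-pos s k₁>0

descendant-bothEndMultsPos : ∀ {j} {p q : Part j} → Descendant p q →
                             BothEndMultsPos p → BothEndMultsPos q
descendant-bothEndMultsPos ε        pos        = pos
descendant-bothEndMultsPos (s ◅ ss) (k₁>0 , _) =
  descendant-bothEndMultsPos ss (step-bothEndMultsPos s k₁>0)

properDescendant-lastMult-pos : ∀ {j} {p q r : Part j} → Step p q → Descendant q r →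
                                0 < firstMult p → 0 < lastMult r
properDescendant-lastMult-pos s ss k₁>0 =
  proj₂ (descendant-bothEndMultsPos ss (step-bothEndMultsPos s k₁>0))

lemma5p11 : (j : ℕ) (ks : Vec ℕ (suc (suc j)))
    → 0 < lookup ks (suc zero) → lastEntry ks ≡ 0 → ¬ Allowable ks
lemma5p11 _ _ () _ (_ , _ , _ , _ , _ , ε)
lemma5p11 _ _ _ kₘ≡0 (_ , _ , _ , _ , _ , s ◅ ss) =
  <-irrefl (sym kₘ≡0) (properDescendant-lastMult-pos s ss z<s)
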